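{- Let $\mathbf{D}_\delta$ be an evaluation-free wff of $\mathcal{Q}^{\rm uqe}_0$ of type $\delta$. Then $\vdash [\![\ulcorner\mathbf{D}_\delta\urcorner]\!]_\delta \simeq \mathbf{D}_\delta$, i.e., this formula is a theorem of $\mathcal{P}^{\rm uqe}$ (provable from the empty set of hypotheses).
   Context: \textbf{Syntax of $\mathcal{Q}^{\rm uqe}_0$.} Types: $\iota$, $o$, $\epsilon$ are types; if $\alpha,\beta$ are types then so are $(\alpha\beta)$ (functions from $\beta$ to $\alpha$) and $\langle\alpha\beta\rangle$ (ordered pairs); $\alpha\beta\gamma$ abbreviates $((\alpha\beta)\gamma)$. Primitive symbols: improper symbols $[\,,\,]\,,\lambda,\mathsf{c},\mathsf{q},\mathsf{e}$; for each type $\alpha$ a denumerable set of variables of type $\alpha$ (boldface $\mathbf{x}_\alpha,\mathbf{y}_\beta,\dots$ range over arbitrary variables; non-bold $x_\alpha,y_\alpha,z_\alpha,g_\alpha,p_\alpha$ denote particular fixed variables); logical constants $\mathsf{Q}_{o\alpha\alpha}$ (every $\alpha$), $\iota_{\alpha(o\alpha)}$ (every $\alpha\neq o$), $\mathsf{pair}_{\langle\alpha\beta\rangle\beta\alpha}$ (every $\alpha,\beta$), $\mathsf{var}_{o\epsilon}$, $\mathsf{con}_{o\epsilon}$, $\mathsf{app}_{\epsilon\epsilon\epsilon}$, $\mathsf{abs}_{\epsilon\epsilon\epsilon}$, $\mathsf{cond}_{\epsilon\epsilon\epsilon\epsilon}$, $\mathsf{quot}_{\epsilon\epsilon}$, $\mathsf{eval}_{\epsilon\epsilon\epsilon}$,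 $\mathsf{eval\text{ - }free}_{o\epsilon}$, $\mathsf{not\text{ - }free\text{ - }in}_{o\epsilon\epsilon}$, $\mathsf{cleanse}_{\epsilon\epsilon}$, $\mathsf{sub}_{\epsilon\epsilon\epsilon\epsilon}$, $\mathsf{wff}^\alpha_{o\epsilon}$ (every $\alpha$); and an unspecified set of nonlogical constants of various types. Logical and nonlogical constants are the primitive constants ($\mathbf{c}_\alpha,\mathbf{d}_\beta$ range over them). Wffs of type $\alpha$: variables and primitive constants of type $\alpha$; applications $[\mathbf{A}_{\alpha\beta}\mathbf{B}_\beta]$ (type $\alpha$); abstractions $[\lambda\mathbf{x}_\beta\mathbf{A}_\alpha]$ (type $\alpha\beta$); conditionals $[\mathsf{c}\mathbf{A}_o\mathbf{B}_\alpha\mathbf{C}_\alpha]$ (type $\alpha$); quotations $[\mathsf{q}\mathbf{A}_\alpha]$ (type $\epsilon$); evaluations $[\mathsf{e}\mathbf{A}_\epsilon\mathbf{x}_\alpha]$ (type $\alpha$). Application associates to the left. A formula is a wff of type $o$. A wff is evaluation-free if every occurrence of an evaluation in it lies within a quotation. The map $\mathcal{E}$ from wffs to wffs of type $\epsilon$ is defined by: $\mathcal{E}(\mathbf{x}_\alpha)=[\mathsf{q}\mathbf{x}_\alpha]$; $\mathcal{E}(\mathbf{c}_\alpha)=[\mathsf{q}\mathbf{c}_\alpha]$; $\mathcal{E}([\mathbf{A}\mathbf{B}])=[\mathsf{app}\,\mathcal{E}(\mathbf{A})\,\mathcal{E}(\mathbf{B})]$; $\mathcal{E}([\lambda\mathbf{x}\mathbf{A}])=[\mathsf{abs}\,\mathcal{E}(\mathbf{x})\,\mathcal{E}(\mathbf{A})]$;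 $\mathcal{E}([\mathsf{c}\mathbf{A}\mathbf{B}\mathbf{C}])=[\mathsf{cond}\,\mathcal{E}(\mathbf{A})\,\mathcal{E}(\mathbf{B})\,\mathcal{E}(\mathbf{C})]$; $\mathcal{E}([\mathsf{q}\mathbf{A}])=[\mathsf{quot}\,\mathcal{E}(\mathbf{A})]$; $\mathcal{E}([\mathsf{e}\mathbf{A}\mathbf{x}])=[\mathsf{eval}\,\mathcal{E}(\mathbf{A})\,\mathcal{E}(\mathbf{x})]$ (type subscripts of the $\epsilon$-constants are dropped). \textbf{Abbreviations.} $[\mathbf{A}_\alpha=\mathbf{B}_\alpha]$ is $[\mathsf{Q}_{o\alpha\alpha}\mathbf{A}\mathbf{B}]$; $[\mathbf{A}_o\equiv\mathbf{B}_o]$ is $[\mathsf{Q}_{ooo}\mathbf{A}\mathbf{B}]$; $T_o$ is $[\mathsf{Q}_{ooo}=\mathsf{Q}_{ooo}]$; $F_o$ is $[[\lambda x_oT_o]=[\lambda x_ox_o]]$; $[\forall\mathbf{x}_\alpha\mathbf{A}_o]$ is $[[\lambda y_\alpha T_o]=[\lambda\mathbf{x}_\alpha\mathbf{A}_o]]$; $\wedge_{ooo}$ is $[\lambda x_o\lambda y_o[[\lambda g_{ooo}[g_{ooo}T_oT_o]]=[\lambda g_{ooo}[g_{ooo}x_oy_o]]]]$; $\supset_{ooo}$ is $[\lambda x_o\lambda y_o[x_o=[x_o\wedge y_o]]]$; ${\sim}_{oo}$ is $[\mathsf{Q}_{ooo}F_o]$; $\vee_{ooo}$ is $[\lambda x_o\lambda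 y_o[{\sim}[[{\sim}x_o]\wedge[{\sim}y_o]]]]$ (infix forms as usual); $[\exists\mathbf{x}\mathbf{A}]$ is ${\sim}[\forall\mathbf{x}{\sim}\mathbf{A}]$; $[\exists_1\mathbf{x}_\alpha\mathbf{A}_o]$ is $[\exists\mathbf{x}_\alpha[[\lambda\mathbf{x}_\alpha\mathbf{A}_o]=\mathsf{Q}_{o\alpha\alpha}\mathbf{x}_\alpha]]$; $\mathbf{A}\neq\mathbf{B}$ is ${\sim}[\mathbf{A}=\mathbf{B}]$; $\mathbf{A}\!\downarrow$ is $[\mathbf{A}=\mathbf{A}]$; $\mathbf{A}\!\uparrow$ is ${\sim}[\mathbf{A}\!\downarrow]$; $[\mathbf{A}\simeq\mathbf{B}]$ is $[[\mathbf{A}\!\downarrow\vee\mathbf{B}\!\downarrow]\supset[\mathbf{A}=\mathbf{B}]]$; $[\mathrm{I}\mathbf{x}_\alpha\mathbf{A}_o]$ is $[\iota_{\alpha(o\alpha)}[\lambda\mathbf{x}_\alpha\mathbf{A}_o]]$ ($\alpha\neq o$); $\bot_o$ is $F_o$ and $\bot_\alpha$ is $[\mathrm{I}x_\alpha[x_\alpha\neq x_\alpha]]$ for $\alpha\neq o$; $[\mathsf{if}\,\mathbf{A}\,\mathbf{B}\,\mathbf{C}]$ is $[\mathsf{c}\mathbf{A}\mathbf{B}\mathbf{C}]$; $\ulcorner\mathbf{A}_\alpha\urcorner$ is $[\mathsf{q}\mathbf{A}_\alpha]$; $[\![\mathbf{A}_\epsilon]\!]_\alpha$ is $[\mathsf{e}\mathbf{A}_\epsilon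 x_\alpha]$; $\mathsf{fst}_{\alpha\langle\alpha\beta\rangle}$ is $\lambda z_{\langle\alpha\beta\rangle}\mathrm{I}x_\alpha\exists y_\beta[z_{\langle\alpha\beta\rangle}=\mathsf{pair}\,x_\alpha\,y_\beta]$ and $\mathsf{snd}$ is analogous; $\mathsf{var}^\alpha_{o\epsilon}$, $\mathsf{con}^\alpha_{o\epsilon}$, $\mathsf{eval\text{ - }free}^\alpha_{o\epsilon}$ are $\lambda x_\epsilon[\mathsf{K}\,x_\epsilon\wedge\mathsf{wff}^\alpha x_\epsilon]$ for $\mathsf{K}=\mathsf{var},\mathsf{con},\mathsf{eval\text{ - }free}$; $\mathsf{syn\text{ - }closed}_{o\epsilon}$ is $\lambda x_\epsilon\forall y_\epsilon[\mathsf{var}\,y_\epsilon\supset\mathsf{not\text{ - }free\text{ - }in}\,y_\epsilon\,x_\epsilon]$. Write $\mathsf{nfi}$ for $\mathsf{not\text{ - }free\text{ - }in}$. \textbf{Specifying axioms} (bold letters $\mathbf{A},\dots,\mathbf{F}$ without subscript are arbitrary wffs of type $\epsilon$; $\alpha,\beta$ arbitrary types). S1: $\ulcorner\mathbf{A}_\alpha\urcorner=\mathcal{E}(\mathbf{A}_\alpha)$. S2: $\mathsf{var}\ulcorner\mathbf{x}_\alpha\urcorner$; ${\sim}\mathsf{var}\ulcorner\mathbf{A}_\alpha\urcorner$ if $\mathbf{A}_\alpha$ is not a variable. S3: $\mathsf{con}\ulcorner\mathbf{c}_\alpha\urcorner$; ${\sim}\mathsf{con}\ulcorner\mathbf{A}_\alpha\urcorner$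 if $\mathbf{A}_\alpha$ is not a primitive constant. S4: ${\sim}[\mathsf{var}\mathbf{A}\wedge\mathsf{con}\mathbf{A}]$; for $\mathsf{K}\in\{\mathsf{var},\mathsf{con}\}$: ${\sim}[\mathsf{K}\mathbf{A}\wedge\mathbf{A}=\mathsf{app}\mathbf{D}\mathbf{E}]$, ${\sim}[\mathsf{K}\mathbf{A}\wedge\mathbf{A}=\mathsf{abs}\mathbf{D}\mathbf{E}]$, ${\sim}[\mathsf{K}\mathbf{A}\wedge\mathbf{A}=\mathsf{cond}\mathbf{D}\mathbf{E}\mathbf{F}]$, ${\sim}[\mathsf{K}\mathbf{A}\wedge\mathbf{A}=\mathsf{quot}\mathbf{D}]$, ${\sim}[\mathsf{K}\mathbf{A}\wedge\mathbf{A}=\mathsf{eval}\mathbf{D}\mathbf{E}]$; distinctness of any two of $\mathsf{app}\mathbf{A}\mathbf{B}$, $\mathsf{abs}\mathbf{A}\mathbf{B}$, $\mathsf{cond}\mathbf{A}\mathbf{B}\mathbf{C}$, $\mathsf{quot}\mathbf{A}$, $\mathsf{eval}\mathbf{A}\mathbf{B}$ built from different constructors (with arbitrary argument wffs); $\ulcorner\mathbf{x}_\alpha\urcorner\neq\ulcorner\mathbf{y}_\beta\urcorner$ for distinct variables; $\ulcorner\mathbf{c}_\alpha\urcorner\neq\ulcorner\mathbf{d}_\beta\urcorner$ for distinct primitive constants; injectivity: $\mathsf{app}\mathbf{A}\mathbf{B}=\mathsf{app}\mathbf{D}\mathbf{E}\supset[\mathbf{A}=\mathbf{D}\wedge\mathbf{B}=\mathbf{E}]$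 and likewise for $\mathsf{abs}$, $\mathsf{cond}$ (three arguments), $\mathsf{quot}$, $\mathsf{eval}$; induction: $[\mathbf{A}^1_o\wedge\dots\wedge\mathbf{A}^7_o]\supset\forall x_\epsilon[p_{o\epsilon}x_\epsilon]$ where $\mathbf{A}^1_o=\forall x_\epsilon[\mathsf{var}x_\epsilon\supset p_{o\epsilon}x_\epsilon]$, $\mathbf{A}^2_o$ the same with $\mathsf{con}$, $\mathbf{A}^3_o=\forall x_\epsilon\forall y_\epsilon[[p x_\epsilon\wedge p y_\epsilon\wedge[\mathsf{app}x_\epsilon y_\epsilon]\!\downarrow]\supset p[\mathsf{app}x_\epsilon y_\epsilon]]$, $\mathbf{A}^4_o$ the same with $\mathsf{abs}$, $\mathbf{A}^5_o=\forall x_\epsilon\forall y_\epsilon\forall z_\epsilon[[px\wedge py\wedge pz\wedge[\mathsf{cond}xyz]\!\downarrow]\supset p[\mathsf{cond}xyz]]$, $\mathbf{A}^6_o=\forall x_\epsilon[px_\epsilon\supset p[\mathsf{quot}x_\epsilon]]$, $\mathbf{A}^7_o$ as $\mathbf{A}^3_o$ with $\mathsf{eval}$. S5: $\mathsf{var}\mathbf{A}\supset\mathsf{eval\text{ - }free}\mathbf{A}$; $\mathsf{con}\mathbf{A}\supset\mathsf{eval\text{ - }free}\mathbf{A}$; $[\mathsf{app}\mathbf{A}\mathbf{B}]\!\downarrow\supset[\mathsf{eval\text{ - }free}[\mathsf{app}\mathbf{A}\mathbf{B}]\equiv[\mathsf{eval\text{ - }free}\mathbf{A}\wedge\mathsf{eval\text{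 - }free}\mathbf{B}]]$; $[\mathsf{abs}\mathbf{A}\mathbf{B}]\!\downarrow\supset[\mathsf{eval\text{ - }free}[\mathsf{abs}\mathbf{A}\mathbf{B}]\equiv\mathsf{eval\text{ - }free}\mathbf{B}]$; $[\mathsf{cond}\mathbf{A}\mathbf{B}\mathbf{C}]\!\downarrow\supset[\mathsf{eval\text{ - }free}[\mathsf{cond}\mathbf{A}\mathbf{B}\mathbf{C}]\equiv$ conjunction of $\mathsf{eval\text{ - }free}$ of $\mathbf{A},\mathbf{B},\mathbf{C}]$; $\mathbf{A}\!\downarrow\supset\mathsf{eval\text{ - }free}[\mathsf{quot}\mathbf{A}]$; ${\sim}\mathsf{eval\text{ - }free}[\mathsf{eval}\mathbf{A}\mathbf{B}]$. S6: $\mathsf{wff}^\alpha\ulcorner\mathbf{x}_\alpha\urcorner$; $\mathsf{wff}^\alpha\ulcorner\mathbf{c}_\alpha\urcorner$; $[\mathsf{wff}^{\alpha\beta}\mathbf{A}\wedge\mathsf{wff}^\beta\mathbf{B}]\supset\mathsf{wff}^\alpha[\mathsf{app}\mathbf{A}\mathbf{B}]$; $[\mathsf{wff}^\iota\mathbf{A}\vee\mathsf{wff}^o\mathbf{A}\vee\mathsf{wff}^\epsilon\mathbf{A}\vee\mathsf{wff}^{\langle\alpha\beta\rangle}\mathbf{A}]\supset[\mathsf{app}\mathbf{A}\mathbf{B}]\!\uparrow$; $[\mathsf{wff}^{\alpha\beta}\mathbf{A}\wedge{\sim}\mathsf{wff}^\beta\mathbf{B}]\supset[\mathsf{app}\mathbf{A}\mathbf{B}]\!\uparrow$;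 $[\mathsf{var}^\alpha\mathbf{A}\wedge\mathsf{wff}^\beta\mathbf{B}]\supset\mathsf{wff}^{\beta\alpha}[\mathsf{abs}\mathbf{A}\mathbf{B}]$; ${\sim}\mathsf{var}\mathbf{A}\supset[\mathsf{abs}\mathbf{A}\mathbf{B}]\!\uparrow$; $[\mathsf{wff}^o\mathbf{A}\wedge\mathsf{wff}^\alpha\mathbf{B}\wedge\mathsf{wff}^\alpha\mathbf{C}]\supset\mathsf{wff}^\alpha[\mathsf{cond}\mathbf{A}\mathbf{B}\mathbf{C}]$; $[{\sim}\mathsf{wff}^o\mathbf{A}\vee[\mathsf{wff}^\alpha\mathbf{B}\wedge\mathsf{wff}^\beta\mathbf{C}]]\supset[\mathsf{cond}\mathbf{A}\mathbf{B}\mathbf{C}]\!\uparrow$ for $\alpha\neq\beta$; $\mathbf{A}\!\downarrow\supset\mathsf{wff}^\epsilon[\mathsf{quot}\mathbf{A}]$; $[\mathsf{wff}^\epsilon\mathbf{A}\wedge\mathsf{var}^\alpha\mathbf{B}]\supset\mathsf{wff}^\alpha[\mathsf{eval}\mathbf{A}\mathbf{B}]$; $[{\sim}\mathsf{wff}^\epsilon\mathbf{A}\vee{\sim}\mathsf{var}\mathbf{B}]\supset[\mathsf{eval}\mathbf{A}\mathbf{B}]\!\uparrow$; ${\sim}[\mathsf{wff}^\alpha\mathbf{A}\wedge\mathsf{wff}^\beta\mathbf{A}]$ for $\alpha\neq\beta$. S7: $\mathsf{var}\mathbf{A}\supset{\sim}\mathsf{nfi}\mathbf{A}\mathbf{A}$;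 $[\mathsf{var}\mathbf{A}\wedge\mathsf{var}\mathbf{B}\wedge\mathbf{A}\neq\mathbf{B}]\supset\mathsf{nfi}\mathbf{A}\mathbf{B}$; $[\mathsf{var}\mathbf{A}\wedge\mathsf{con}\mathbf{B}]\supset\mathsf{nfi}\mathbf{A}\mathbf{B}$; $[\mathsf{var}\mathbf{A}\wedge[\mathsf{app}\mathbf{B}\mathbf{C}]\!\downarrow]\supset[\mathsf{nfi}\mathbf{A}[\mathsf{app}\mathbf{B}\mathbf{C}]\equiv[\mathsf{nfi}\mathbf{A}\mathbf{B}\wedge\mathsf{nfi}\mathbf{A}\mathbf{C}]]$; $[\mathsf{var}\mathbf{A}\wedge[\mathsf{abs}\mathbf{A}\mathbf{B}]\!\downarrow]\supset\mathsf{nfi}\mathbf{A}[\mathsf{abs}\mathbf{A}\mathbf{B}]$; $[\mathsf{var}\mathbf{A}\wedge\mathsf{var}\mathbf{B}\wedge\mathbf{A}\neq\mathbf{B}\wedge[\mathsf{abs}\mathbf{B}\mathbf{C}]\!\downarrow]\supset[\mathsf{nfi}\mathbf{A}[\mathsf{abs}\mathbf{B}\mathbf{C}]\equiv\mathsf{nfi}\mathbf{A}\mathbf{C}]$; $[\mathsf{var}\mathbf{A}\wedge[\mathsf{cond}\mathbf{D}\mathbf{E}\mathbf{F}]\!\downarrow]\supset[\mathsf{nfi}\mathbf{A}[\mathsf{cond}\mathbf{D}\mathbf{E}\mathbf{F}]\equiv[\mathsf{nfi}\mathbf{A}\mathbf{D}\wedge\mathsf{nfi}\mathbf{A}\mathbf{E}\wedge\mathsf{nfi}\mathbf{A}\mathbf{F}]]$;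 $[\mathsf{var}\mathbf{A}\wedge\mathbf{B}\!\downarrow]\supset\mathsf{nfi}\mathbf{A}[\mathsf{quot}\mathbf{B}]$; $[\mathsf{var}\mathbf{A}\wedge\mathsf{var}^\alpha\mathbf{C}\wedge[\mathsf{eval}\mathbf{B}\mathbf{C}]\!\downarrow]\supset[\mathsf{nfi}\mathbf{A}[\mathsf{eval}\mathbf{B}\mathbf{C}]\equiv[\mathsf{syn\text{ - }closed}\mathbf{B}\wedge\mathsf{eval\text{ - }free}^\epsilon\mathbf{B}\wedge\mathsf{eval\text{ - }free}^\alpha[\![\mathbf{B}]\!]_\epsilon\wedge\mathsf{nfi}\mathbf{A}[\![\mathbf{B}]\!]_\epsilon]]$; ${\sim}\mathsf{var}\mathbf{A}\supset\mathsf{nfi}\mathbf{A}\mathbf{B}$. S8: $\mathsf{var}\mathbf{A}\supset\mathsf{cleanse}\mathbf{A}=\mathbf{A}$; $\mathsf{con}\mathbf{A}\supset\mathsf{cleanse}\mathbf{A}=\mathbf{A}$; $[\mathsf{app}\mathbf{A}\mathbf{B}]\!\downarrow\supset[\mathsf{cleanse}[\mathsf{app}\mathbf{A}\mathbf{B}]\simeq\mathsf{app}[\mathsf{cleanse}\mathbf{A}][\mathsf{cleanse}\mathbf{B}]]$; $[\mathsf{abs}\mathbf{A}\mathbf{B}]\!\downarrow\supset[\mathsf{cleanse}[\mathsf{abs}\mathbf{A}\mathbf{B}]\simeq\mathsf{abs}\mathbf{A}[\mathsf{cleanse}\mathbf{B}]]$; $[\mathsf{cond}\mathbf{A}\mathbf{B}\mathbf{C}]\!\downarrow\supset[\mathsf{cleanse}[\mathsf{cond}\mathbf{A}\mathbf{B}\mathbf{C}]\simeq\mathsf{cond}[\mathsf{cleanse}\mathbf{A}][\mathsf{cleanse}\mathbf{B}][\mathsf{cleanse}\mathbf{C}]]$;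 $\mathsf{cleanse}[\mathsf{quot}\mathbf{A}]\simeq\mathsf{quot}\mathbf{A}$; $[\mathsf{var}^\alpha\mathbf{B}\wedge[\mathsf{eval}\mathbf{A}\mathbf{B}]\!\downarrow]\supset[\mathsf{cleanse}[\mathsf{eval}\mathbf{A}\mathbf{B}]\simeq\mathsf{if}[\mathsf{syn\text{ - }closed}\mathbf{E}\wedge\mathsf{eval\text{ - }free}^\alpha[\![\mathbf{E}]\!]_\epsilon][\![\mathbf{E}]\!]_\epsilon\bot_\epsilon]$ with $\mathbf{E}=\mathsf{cleanse}\mathbf{A}$. S9 (each with the extra hypothesis $\mathsf{wff}^\alpha\mathbf{A}\wedge\mathsf{var}^\alpha\mathbf{B}$ in the antecedent, abbreviated $H$): $H\supset\mathsf{sub}\mathbf{A}\mathbf{B}\mathbf{B}=\mathsf{cleanse}\mathbf{A}$; $[H\wedge\mathsf{var}\mathbf{C}\wedge\mathbf{B}\neq\mathbf{C}]\supset\mathsf{sub}\mathbf{A}\mathbf{B}\mathbf{C}=\mathbf{C}$; $[H\wedge\mathsf{con}\mathbf{C}]\supset\mathsf{sub}\mathbf{A}\mathbf{B}\mathbf{C}=\mathbf{C}$; $[H\wedge[\mathsf{app}\mathbf{D}\mathbf{E}]\!\downarrow]\supset[\mathsf{sub}\mathbf{A}\mathbf{B}[\mathsf{app}\mathbf{D}\mathbf{E}]\simeq\mathsf{app}[\mathsf{sub}\mathbf{A}\mathbf{B}\mathbf{D}][\mathsf{sub}\mathbf{A}\mathbf{B}\mathbf{E}]]$; $[H\wedge[\mathsf{abs}\mathbf{B}\mathbf{E}]\!\downarrow]\supset[\mathsf{sub}\mathbf{A}\mathbf{B}[\mathsf{abs}\mathbf{B}\mathbf{E}]\simeq\mathsf{abs}\mathbf{B}[\mathsf{cleanse}\mathbf{E}]]$;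 $[H\wedge\mathsf{var}\mathbf{D}\wedge\mathbf{B}\neq\mathbf{D}\wedge[\mathsf{abs}\mathbf{D}\mathbf{E}]\!\downarrow]\supset[\mathsf{sub}\mathbf{A}\mathbf{B}[\mathsf{abs}\mathbf{D}\mathbf{E}]\simeq\mathsf{if}[\mathsf{nfi}\mathbf{B}\mathbf{E}\vee\mathsf{nfi}\mathbf{D}\mathbf{A}][\mathsf{abs}\mathbf{D}[\mathsf{sub}\mathbf{A}\mathbf{B}\mathbf{E}]]\bot_\epsilon]$; $[H\wedge[\mathsf{cond}\mathbf{D}\mathbf{E}\mathbf{F}]\!\downarrow]\supset[\mathsf{sub}\mathbf{A}\mathbf{B}[\mathsf{cond}\mathbf{D}\mathbf{E}\mathbf{F}]\simeq\mathsf{cond}[\mathsf{sub}\mathbf{A}\mathbf{B}\mathbf{D}][\mathsf{sub}\mathbf{A}\mathbf{B}\mathbf{E}][\mathsf{sub}\mathbf{A}\mathbf{B}\mathbf{F}]]$; $[H\wedge\mathbf{C}\!\downarrow]\supset\mathsf{sub}\mathbf{A}\mathbf{B}[\mathsf{quot}\mathbf{C}]=\mathsf{quot}\mathbf{C}$; $[H\wedge\mathsf{var}^\beta\mathbf{E}\wedge[\mathsf{eval}\mathbf{D}\mathbf{E}]\!\downarrow]\supset[\mathsf{sub}\mathbf{A}\mathbf{B}[\mathsf{eval}\mathbf{D}\mathbf{E}]\simeq\mathsf{if}[\mathsf{syn\text{ - }closed}\mathbf{E}^1\wedge\mathsf{eval\text{ - }free}^\beta[\![\mathbf{E}^1]\!]_\epsilon]\mathbf{E}^2\bot_\epsilon]$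 with $\mathbf{E}^1=\mathsf{sub}\mathbf{A}\mathbf{B}\mathbf{D}$, $\mathbf{E}^2=\mathsf{sub}\mathbf{A}\mathbf{B}[\![\mathbf{E}^1]\!]_\epsilon$; $[\mathsf{wff}^\alpha\mathbf{A}\wedge{\sim}\mathsf{var}^\alpha\mathbf{B}]\supset[\mathsf{sub}\mathbf{A}\mathbf{B}\mathbf{C}]\!\uparrow$. \textbf{Proof system $\mathcal{P}^{\rm uqe}$.} Axioms (all instances): (1) $[\mathbf{G}_{oo}T_o\wedge\mathbf{G}_{oo}F_o]\equiv\forall\mathbf{x}_o[\mathbf{G}_{oo}\mathbf{x}_o]$; (2) $\mathbf{A}_\alpha=\mathbf{B}_\alpha\supset[\mathbf{H}_{o\alpha}\mathbf{A}_\alpha\equiv\mathbf{H}_{o\alpha}\mathbf{B}_\alpha]$; (3) $[\mathbf{F}_{\alpha\beta}\!\downarrow\wedge\mathbf{G}_{\alpha\beta}\!\downarrow]\supset[\mathbf{F}=\mathbf{G}\equiv\forall\mathbf{x}_\beta[\mathbf{F}\mathbf{x}_\beta\simeq\mathbf{G}\mathbf{x}_\beta]]$; (4.1) $[\mathbf{A}_\alpha\!\downarrow\wedge\mathsf{sub}\ulcorner\mathbf{A}_\alpha\urcorner\ulcorner\mathbf{x}_\alpha\urcorner\ulcorner\mathbf{B}_\beta\urcorner=\ulcorner\mathbf{C}_\beta\urcorner]\supset[[\lambda\mathbf{x}_\alpha\mathbf{B}_\beta]\mathbf{A}_\alpha\simeq\mathbf{C}_\beta]$; (4.2) $[\lambda\mathbf{x}_\alpha\mathbf{x}_\alpha]\mathbf{A}_\alpha\simeq\mathbf{A}_\alpha$;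 (4.3) $\mathbf{A}_\alpha\!\downarrow\supset[[\lambda\mathbf{x}_\alpha\mathbf{y}_\beta]\mathbf{A}_\alpha\simeq\mathbf{y}_\beta]$, $\mathbf{x}_\alpha\neq\mathbf{y}_\beta$; (4.4) $\mathbf{A}_\alpha\!\downarrow\supset[[\lambda\mathbf{x}_\alpha\mathbf{c}_\beta]\mathbf{A}_\alpha\simeq\mathbf{c}_\beta]$; (4.5) $[\lambda\mathbf{x}_\alpha[\mathbf{B}_{\gamma\beta}\mathbf{C}_\beta]]\mathbf{A}_\alpha\simeq[[\lambda\mathbf{x}_\alpha\mathbf{B}_{\gamma\beta}]\mathbf{A}_\alpha][[\lambda\mathbf{x}_\alpha\mathbf{C}_\beta]\mathbf{A}_\alpha]$; (4.6) $\mathbf{A}_\alpha\!\downarrow\supset[[\lambda\mathbf{x}_\alpha[\lambda\mathbf{x}_\alpha\mathbf{B}_\beta]]\mathbf{A}_\alpha=\lambda\mathbf{x}_\alpha\mathbf{B}_\beta]$; (4.7) $[\mathbf{A}_\alpha\!\downarrow\wedge[\mathsf{nfi}\ulcorner\mathbf{x}_\alpha\urcorner\ulcorner\mathbf{B}_\gamma\urcorner\vee\mathsf{nfi}\ulcorner\mathbf{y}_\beta\urcorner\ulcorner\mathbf{A}_\alpha\urcorner]]\supset[[\lambda\mathbf{x}_\alpha[\lambda\mathbf{y}_\beta\mathbf{B}_\gamma]]\mathbf{A}_\alpha=\lambda\mathbf{y}_\beta[[\lambda\mathbf{x}_\alpha\mathbf{B}_\gamma]\mathbf{A}_\alpha]]$,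 $\mathbf{x}_\alpha\neq\mathbf{y}_\beta$; (4.8) $[\lambda\mathbf{x}_\alpha[\mathsf{if}\,\mathbf{B}_o\mathbf{C}_\beta\mathbf{D}_\beta]]\mathbf{A}_\alpha\simeq\mathsf{if}\,[[\lambda\mathbf{x}_\alpha\mathbf{B}_o]\mathbf{A}_\alpha]\,[[\lambda\mathbf{x}_\alpha\mathbf{C}_\beta]\mathbf{A}_\alpha]\,[[\lambda\mathbf{x}_\alpha\mathbf{D}_\beta]\mathbf{A}_\alpha]$; (4.9) $\mathbf{A}_\alpha\!\downarrow\supset[[\lambda\mathbf{x}_\alpha\ulcorner\mathbf{B}_\beta\urcorner]\mathbf{A}_\alpha\simeq\ulcorner\mathbf{B}_\beta\urcorner]$; (4.10) $[\lambda\mathbf{x}_\alpha\mathbf{B}_\beta]\mathbf{x}_\alpha\simeq\mathbf{B}_\beta$; (5) every tautologous formula (substitution instance of a propositional tautology in $T_o,F_o,{\sim},\wedge,\vee,\supset,\equiv$); (6) $\mathbf{x}_\alpha\!\downarrow$; $\mathbf{c}_\alpha\!\downarrow$; $[\mathbf{A}_{o\beta}\mathbf{B}_\beta]\!\downarrow$; $[\mathbf{A}_{\alpha\beta}\!\uparrow\vee\mathbf{B}_\beta\!\uparrow]\supset[\mathbf{A}_{\alpha\beta}\mathbf{B}_\beta\simeq\bot_\alpha]$; $[\lambda\mathbf{x}_\alpha\mathbf{B}_\beta]\!\downarrow$; $[\mathsf{if}\,\mathbf{A}_o\mathbf{B}_o\mathbf{C}_o]\!\downarrow$; $\ulcorner\mathbf{A}_\alpha\urcorner\!\downarrow$;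 $[\![\mathbf{A}_\epsilon]\!]_o\!\downarrow$; $[\![\ulcorner\ulcorner\mathbf{A}_\alpha\urcorner\urcorner]\!]_\epsilon\!\downarrow$; ${\sim}\mathsf{eval\text{ - }free}^\alpha\mathbf{A}_\epsilon\supset[[\![\mathbf{A}_\epsilon]\!]_\alpha\simeq\bot_\alpha]$; $\bot_\alpha\!\uparrow$ ($\alpha\neq o$); (7) $\mathbf{A}_\alpha\simeq\mathbf{A}_\alpha$; (8) $\exists_1\mathbf{x}_\alpha\mathbf{A}_o\equiv[\mathrm{I}\mathbf{x}_\alpha\mathbf{A}_o]\!\downarrow$ and $[\exists_1\mathbf{x}_\alpha\mathbf{A}_o\wedge\mathsf{sub}\ulcorner\mathrm{I}\mathbf{x}_\alpha\mathbf{A}_o\urcorner\ulcorner\mathbf{x}_\alpha\urcorner\ulcorner\mathbf{A}_o\urcorner=\ulcorner\mathbf{B}_o\urcorner]\supset\mathbf{B}_o$ ($\alpha\neq o$); (9) $[\mathsf{pair}\mathbf{A}_\alpha\mathbf{B}_\beta=\mathsf{pair}\mathbf{C}_\alpha\mathbf{D}_\beta]\equiv[\mathbf{A}=\mathbf{C}\wedge\mathbf{B}=\mathbf{D}]$ and $\mathbf{A}_{\langle\alpha\beta\rangle}\!\downarrow\supset\exists\mathbf{x}_\alpha\exists\mathbf{y}_\beta[\mathbf{A}_{\langle\alpha\beta\rangle}=\mathsf{pair}\mathbf{x}_\alpha\mathbf{y}_\beta]$; (10) $\mathsf{if}\,T_o\mathbf{B}\mathbf{C}\simeq\mathbf{B}$;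 $\mathsf{if}\,F_o\mathbf{B}\mathbf{C}\simeq\mathbf{C}$; $[\![\mathsf{if}\,\mathbf{A}_o\mathbf{B}_\epsilon\mathbf{C}_\epsilon]\!]_\alpha\simeq\mathsf{if}\,\mathbf{A}_o[\![\mathbf{B}_\epsilon]\!]_\alpha[\![\mathbf{C}_\epsilon]\!]_\alpha$; (11) $[\![\ulcorner\mathbf{x}_\alpha\urcorner]\!]_\alpha=\mathbf{x}_\alpha$; $[\![\ulcorner\mathbf{c}_\alpha\urcorner]\!]_\alpha=\mathbf{c}_\alpha$; $\mathsf{wff}^{\alpha\beta}\mathbf{A}_\epsilon\supset[[\![\mathsf{app}\mathbf{A}_\epsilon\mathbf{B}_\epsilon]\!]_\alpha\simeq[\![\mathbf{A}_\epsilon]\!]_{\alpha\beta}[\![\mathbf{B}_\epsilon]\!]_\beta]$; $\mathsf{nfi}\ulcorner\mathbf{x}_\alpha\urcorner\ulcorner\mathbf{B}_\epsilon\urcorner\supset[[\![\mathsf{abs}\ulcorner\mathbf{x}_\alpha\urcorner\mathbf{B}_\epsilon]\!]_{\beta\alpha}\simeq\lambda\mathbf{x}_\alpha[\![\mathbf{B}_\epsilon]\!]_\beta]$; $[\![\mathsf{cond}\mathbf{A}_\epsilon\mathbf{B}_\epsilon\mathbf{C}_\epsilon]\!]_\alpha\simeq\mathsf{if}[\![\mathbf{A}_\epsilon]\!]_o[\![\mathbf{B}_\epsilon]\!]_\alpha[\![\mathbf{C}_\epsilon]\!]_\alpha$; $[\![\mathsf{quot}\mathbf{A}_\epsilon]\!]_\epsilon\!\downarrow\supset[\![\mathsf{quot}\mathbf{A}_\epsilon]\!]_\epsilon=\mathbf{A}_\epsilon$;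 (12) every specifying axiom S1–S9. Rules: (R1) from $\mathbf{A}_\alpha\simeq\mathbf{B}_\alpha$ and $\mathbf{C}_o$ infer the result of replacing one occurrence of $\mathbf{A}_\alpha$ in $\mathbf{C}_o$ by $\mathbf{B}_\alpha$, provided that occurrence is not within a quotation, not the bound variable of a $\lambda$-abstraction, and not the second argument of an evaluation; (R2) from $\mathbf{A}_o$ and $\mathbf{A}_o\supset\mathbf{B}_o$ infer $\mathbf{B}_o$. $\vdash\mathbf{A}_o$ means there is a finite sequence of formulas ending in $\mathbf{A}_o$, each an axiom or obtained from earlier members by a rule. -}

module Defs where

open import Data.Nat using (ℕ)
open import Data.Bool using (Bool; true; false; T)
open import Data.Product using (Σ; _,_; _×_)
open import Data.Sum using (_⊎_; inj₁; inj₂)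
open import Data.Empty using (⊥)
open import Data.Unit using (⊤)
open import Relation.Binary.PropositionalEquality using (_≡_)
open import Relation.Nullary using (¬_)

-- Types.  fn α β is the paper's (αβ): functions from β to α.
-- pr α β is the paper's ⟨αβ⟩.

data Ty : Set where
  ι o ε : Ty
  fn : Ty → Ty → Ty
  pr : Ty → Ty → Ty

notO : Ty → Bool
notO o = false
notO _ = true

data LCon : Ty → Set where
  Q          : (α : Ty) → LCon (fn (fn o α) α)
  iota       : (α : Ty) → {T (notO α)} → LCon (fn α (fn o α))
  pair       : (α β : Ty) → LCon (fn (fn (pr α β) β) α)
  var-c      : LCon (fn o ε)
  con-c      : LCon (fn o ε)
  app-c      : LCon (fn (fn ε ε) ε)
  abs-c      : LCon (fn (fn ε ε) ε)
  cond-c     : LCon (fn (fn (fn ε ε) ε) ε)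
  quot-c     : LCon (fn ε ε)
  eval-c     : LCon (fn (fn ε ε) ε)
  evalfree-c : LCon (fn o ε)
  nfi-c      : LCon (fn (fn o ε) ε)
  cleanse-c  : LCon (fn ε ε)
  sub-c      : LCon (fn (fn (fn ε ε) ε) ε)
  wff-c      : (α : Ty) → LCon (fn o ε)

data Var (α : Ty) : Set where
  v : ℕ → Var α

xV yV zV gV pV : (α : Ty) → Var α
xV _ = v 0
yV _ = v 1
zV _ = v 2
gV _ = v 3
pV _ = v 4

data PF : Set where
  atom : ℕ → PF
  pT pF : PF
  pnot : PF → PF
  pand por pimp piff : PF → PF → PF

bnot : Bool → Bool
bnot true = false
bnot false = true

band bor bimp biff : Bool → Bool → Bool
band true b = b
band false _ = false
bor true _ = true
bor false b = b
bimp a b = bor (bnot a) b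
biff true b = b
biff false b = bnot b

evalPF : (ℕ → Bool) → PF → Bool
evalPF ρ (atom n) = ρ n
evalPF ρ pT = true
evalPF ρ pF = false
evalPF ρ (pnot a) = bnot (evalPF ρ a)
evalPF ρ (pand a b) = band (evalPF ρ a) (evalPF ρ b)
evalPF ρ (por a b) = bor (evalPF ρ a) (evalPF ρ b)
evalPF ρ (pimp a b) = bimp (evalPF ρ a) (evalPF ρ b)
evalPF ρ (piff a b) = biff (evalPF ρ a) (evalPF ρ b)

Tautology : PF → Set
Tautology φ = ∀ (ρ : ℕ → Bool) → evalPF ρ φ ≡ true

module Lang (NC : Ty → Set) where

  Const : Ty → Set
  Const α = LCon α ⊎ NC α

  data Wff : Ty → Set where
    var  : ∀ {α} → Var α → Wff α
    con  : ∀ {α} → Const α → Wff α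
    app  : ∀ {α β} → Wff (fn α β) → Wff β → Wff α
    lam  : ∀ {α β} → Var β → Wff α → Wff (fn α β)
    cond : ∀ {α} → Wff o → Wff α → Wff α → Wff α
    quo  : ∀ {α} → Wff α → Wff ε
    ev   : ∀ {α} → Wff ε → Var α → Wff α

  -- evaluation-free: every evaluation occurs within a quotation
  data EvalFree : ∀ {α} → Wff α → Set where
    efVar  : ∀ {α} {x : Var α} → EvalFree (var x)
    efCon  : ∀ {α} {c : Const α} → EvalFree (con c)
    efApp  : ∀ {α β} {A : Wff (fn α β)} {B : Wff β} →
             EvalFree A → EvalFree B → EvalFree (app A B)
    efLam  : ∀ {α β} {x : Var β} {A : Wff α} → EvalFree A → EvalFree (lam x A)
    efCond : ∀ {α} {A : Wff o} {B C : Wff α} →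
             EvalFree A → EvalFree B → EvalFree C → EvalFree (cond A B C)
    efQuo  : ∀ {α} {A : Wff α} → EvalFree (quo A)

  NotVar : ∀ {α} → Wff α → Set
  NotVar (var _) = ⊥
  NotVar _ = ⊤

  NotCon : ∀ {α} → Wff α → Set
  NotCon (con _) = ⊥
  NotCon _ = ⊤

  DistinctVars : ∀ {α β} → Var α → Var β → Set
  DistinctVars {α} {β} x y = ¬ (_≡_ {A = Σ Ty Var} (α , x) (β , y))

  DistinctCons : ∀ {α β} → Const α → Const β → Set
  DistinctCons {α} {β} c d = ¬ (_≡_ {A = Σ Ty Const} (α , c) (β , d))

  data Occ {α} (x : Var α) : ∀ {β} → Wff β → Set where
    oVar   : Occ x (var x)
    oLamB  : ∀ {β} {A : Wff β} → Occ x (lam x A)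
    oLam   : ∀ {β γ} {y : Var γ} {A : Wff β} → Occ x A → Occ x (lam y A)
    oAppL  : ∀ {β γ} {A : Wff (fn β γ)} {B : Wff γ} → Occ x A → Occ x (app A B)
    oAppR  : ∀ {β γ} {A : Wff (fn β γ)} {B : Wff γ} → Occ x B → Occ x (app A B)
    oCond1 : ∀ {β} {A : Wff o} {B C : Wff β} → Occ x A → Occ x (cond A B C)
    oCond2 : ∀ {β} {A : Wff o} {B C : Wff β} → Occ x B → Occ x (cond A B C)
    oCond3 : ∀ {β} {A : Wff o} {B C : Wff β} → Occ x C → Occ x (cond A B C)
    oQuo   : ∀ {β} {A : Wff β} → Occ x A → Occ x (quo A)
    oEvL   : ∀ {β} {A : Wff ε} {y : Var β} → Occ x A → Occ x (ev A y)
    oEvR   : ∀ {A : Wff ε} → Occ x (ev A x)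

  lc : ∀ {α} → LCon α → Wff α
  lc c = con (inj₁ c)

  infix 5 _≐_ _≃_ _≠_
  infixl 7 _∧_
  infixl 6 _∨_
  infixr 4 _⊃_
  infix 8 ~_
  infix 9 _↓ _↑

  _≐_ : ∀ {α} → Wff α → Wff α → Wff o
  _≐_ {α} A B = app (app (lc (Q α)) A) B

  Tₒ : Wff o
  Tₒ = lc (Q o) ≐ lc (Q o)

  Fₒ : Wff o
  Fₒ = lam (xV o) Tₒ ≐ lam (xV o) (var (xV o))

  ∀ₒ : ∀ {α} → Var α → Wff o → Wff o
  ∀ₒ {α} x A = lam (yV α) Tₒ ≐ lam x A

  AND : Wff (fn (fn o o) o)
  AND = lam (xV o) (lam (yV o)
          (lam g (app (app (var g) Tₒ) Tₒ)
           ≐ lam g (app (app (var g) (var (xV o))) (var (yV o)))))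
    where g = gV (fn (fn o o) o)

  _∧_ : Wff o → Wff o → Wff o
  A ∧ B = app (app AND A) B

  IMP : Wff (fn (fn o o) o)
  IMP = lam (xV o) (lam (yV o) (var (xV o) ≐ (var (xV o) ∧ var (yV o))))

  _⊃_ : Wff o → Wff o → Wff o
  A ⊃ B = app (app IMP A) B

  NOT : Wff (fn o o)
  NOT = app (lc (Q o)) Fₒ

  ~_ : Wff o → Wff o
  ~ A = app NOT A

  OR : Wff (fn (fn o o) o)
  OR = lam (xV o) (lam (yV o) (~ ((~ var (xV o)) ∧ (~ var (yV o)))))

  _∨_ : Wff o → Wff o → Wff o
  A ∨ B = app (app OR A) B

  ∃ₒ : ∀ {α} → Var α → Wff o → Wff o
  ∃ₒ x A = ~ (∀ₒ x (~ A))

  ∃₁ : ∀ {α} → Var α → Wff o → Wff o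
  ∃₁ {α} x A = ∃ₒ x (lam x A ≐ app (lc (Q α)) (var x))

  _≠_ : ∀ {α} → Wff α → Wff α → Wff o
  A ≠ B = ~ (A ≐ B)

  _↓ : ∀ {α} → Wff α → Wff o
  A ↓ = A ≐ A

  _↑ : ∀ {α} → Wff α → Wff o
  A ↑ = ~ (A ↓)

  _≃_ : ∀ {α} → Wff α → Wff α → Wff o
  A ≃ B = ((A ↓) ∨ (B ↓)) ⊃ (A ≐ B)

  Iota : ∀ {α} {p : T (notO α)} → Var α → Wff o → Wff α
  Iota {α} {p} x A = app (lc (iota α {p})) (lam x A)

  bot : (α : Ty) → Wff α
  bot o = Fₒ
  bot ι = Iota (xV ι) (var (xV ι) ≠ var (xV ι))
  bot ε = Iota (xV ε) (var (xV ε) ≠ var (xV ε))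
  bot (fn α β) = Iota (xV (fn α β)) (var (xV (fn α β)) ≠ var (xV (fn α β)))
  bot (pr α β) = Iota (xV (pr α β)) (var (xV (pr α β)) ≠ var (xV (pr α β)))

  ⌜_⌝ : ∀ {α} → Wff α → Wff ε
  ⌜ A ⌝ = quo A

  ⟦_⟧ : Wff ε → (α : Ty) → Wff α
  ⟦ A ⟧ α = ev A (xV α)

  pairW : ∀ {α β} → Wff α → Wff β → Wff (pr α β)
  pairW {α} {β} A B = app (app (lc (pair α β)) A) B

  isVar isCon evalFree : Wff ε → Wff o
  isVar A = app (lc var-c) A
  isCon A = app (lc con-c) A
  evalFree A = app (lc evalfree-c) A

  wff : Ty → Wff ε → Wff o
  wff α A = app (lc (wff-c α)) A

  appE absE evalE : Wff ε → Wff ε → Wff ε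
  appE A B = app (app (lc app-c) A) B
  absE A B = app (app (lc abs-c) A) B
  evalE A B = app (app (lc eval-c) A) B

  condE : Wff ε → Wff ε → Wff ε → Wff ε
  condE A B C = app (app (app (lc cond-c) A) B) C

  quotE cleanse : Wff ε → Wff ε
  quotE A = app (lc quot-c) A
  cleanse A = app (lc cleanse-c) A

  nfi : Wff ε → Wff ε → Wff o
  nfi A B = app (app (lc nfi-c) A) B

  sub : Wff ε → Wff ε → Wff ε → Wff ε
  sub A B C = app (app (app (lc sub-c) A) B) C

  varα conα evalFreeα : Ty → Wff (fn o ε)
  varα α = lam (xV ε) (isVar (var (xV ε)) ∧ wff α (var (xV ε)))
  conα α = lam (xV ε) (isCon (var (xV ε)) ∧ wff α (var (xV ε)))
  evalFreeα α = lam (xV ε) (evalFree (var (xV ε)) ∧ wff α (var (xV ε)))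

  isVar^ isCon^ evalFree^ : Ty → Wff ε → Wff o
  isVar^ α A = app (varα α) A
  isCon^ α A = app (conα α) A
  evalFree^ α A = app (evalFreeα α) A

  synClosed : Wff (fn o ε)
  synClosed = lam (xV ε) (∀ₒ (yV ε) (isVar (var (yV ε)) ⊃ nfi (var (yV ε)) (var (xV ε))))

  syn-closed : Wff ε → Wff o
  syn-closed A = app synClosed A

  ℰ : ∀ {α} → Wff α → Wff ε
  ℰ (var x) = quo (var x)
  ℰ (con c) = quo (con c)
  ℰ (app A B) = appE (ℰ A) (ℰ B)
  ℰ (lam x A) = absE (ℰ (var x)) (ℰ A)
  ℰ (cond A B C) = condE (ℰ A) (ℰ B) (ℰ C)
  ℰ (quo A) = quotE (ℰ A)
  ℰ (ev A x) = evalE (ℰ A) (ℰ (var x))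

  inst : (ℕ → Wff o) → PF → Wff o
  inst σ (atom n) = σ n
  inst σ pT = Tₒ
  inst σ pF = Fₒ
  inst σ (pnot a) = ~ inst σ a
  inst σ (pand a b) = inst σ a ∧ inst σ b
  inst σ (por a b) = inst σ a ∨ inst σ b
  inst σ (pimp a b) = inst σ a ⊃ inst σ b
  inst σ (piff a b) = inst σ a ≐ inst σ b

  data Kind : Set where
    kApp kAbs kCond kQuot kEval : Kind

  data CT : Set where
    ctApp ctAbs ctEval : Wff ε → Wff ε → CT
    ctCond : Wff ε → Wff ε → Wff ε → CT
    ctQuot : Wff ε → CT

  kind : CT → Kind
  kind (ctApp _ _) = kApp
  kind (ctAbs _ _) = kAbs
  kind (ctEval _ _) = kEval
  kind (ctCond _ _ _) = kCond
  kind (ctQuot _) = kQuot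

  ctW : CT → Wff ε
  ctW (ctApp A B) = appE A B
  ctW (ctAbs A B) = absE A B
  ctW (ctEval A B) = evalE A B
  ctW (ctCond A B C) = condE A B C
  ctW (ctQuot A) = quotE A

  data VC : Set where
    kVar kCon : VC

  vcW : VC → Wff ε → Wff o
  vcW kVar A = isVar A
  vcW kCon A = isCon A

  pε : Wff (fn o ε)
  pε = var (pV (fn o ε))

  P : Wff ε → Wff o
  P A = app pε A

  xε yε zε : Wff ε
  xε = var (xV ε)
  yε = var (yV ε)
  zε = var (zV ε)

  Ind : Wff o
  Ind = (A1 ∧ A2 ∧ A3 ∧ A4 ∧ A5 ∧ A6 ∧ A7) ⊃ ∀ₒ (xV ε) (P xε)
    where
    A1 = ∀ₒ (xV ε) (isVar xε ⊃ P xε)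
    A2 = ∀ₒ (xV ε) (isCon xε ⊃ P xε)
    A3 = ∀ₒ (xV ε) (∀ₒ (yV ε) ((P xε ∧ P yε ∧ (appE xε yε) ↓) ⊃ P (appE xε yε)))
    A4 = ∀ₒ (xV ε) (∀ₒ (yV ε) ((P xε ∧ P yε ∧ (absE xε yε) ↓) ⊃ P (absE xε yε)))
    A5 = ∀ₒ (xV ε) (∀ₒ (yV ε) (∀ₒ (zV ε)
           ((P xε ∧ P yε ∧ P zε ∧ (condE xε yε zε) ↓) ⊃ P (condE xε yε zε))))
    A6 = ∀ₒ (xV ε) (P xε ⊃ P (quotE xε))
    A7 = ∀ₒ (xV ε) (∀ₒ (yV ε) ((P xε ∧ P yε ∧ (evalE xε yε) ↓) ⊃ P (evalE xε yε)))

  data SpecAxiom : Wff o → Set where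
    s1 : ∀ {α} (A : Wff α) → SpecAxiom (⌜ A ⌝ ≐ ℰ A)
    s2a : ∀ {α} (x : Var α) → SpecAxiom (isVar ⌜ var x ⌝)
    s2b : ∀ {α} (A : Wff α) → NotVar A → SpecAxiom (~ isVar ⌜ A ⌝)
    s3a : ∀ {α} (c : Const α) → SpecAxiom (isCon ⌜ con c ⌝)
    s3b : ∀ {α} (A : Wff α) → NotCon A → SpecAxiom (~ isCon ⌜ A ⌝)
    s4a : (A : Wff ε) → SpecAxiom (~ (isVar A ∧ isCon A))
    s4b : (K : VC) (A : Wff ε) (t : CT) → SpecAxiom (~ (vcW K A ∧ (A ≐ ctW t)))
    s4c : (s t : CT) → ¬ (kind s ≡ kind t) → SpecAxiom (ctW s ≠ ctW t)
    s4d : ∀ {α β} (x : Var α) (y : Var β) → DistinctVars x y →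
          SpecAxiom (⌜ var x ⌝ ≠ ⌜ var y ⌝)
    s4e : ∀ {α β} (c : Const α) (d : Const β) → DistinctCons c d →
          SpecAxiom (⌜ con c ⌝ ≠ ⌜ con d ⌝)
    s4f : (A B D E : Wff ε) → SpecAxiom ((appE A B ≐ appE D E) ⊃ ((A ≐ D) ∧ (B ≐ E)))
    s4g : (A B D E : Wff ε) → SpecAxiom ((absE A B ≐ absE D E) ⊃ ((A ≐ D) ∧ (B ≐ E)))
    s4h : (A B C D E F : Wff ε) →
          SpecAxiom ((condE A B C ≐ condE D E F) ⊃ ((A ≐ D) ∧ (B ≐ E) ∧ (C ≐ F)))
    s4i : (A D : Wff ε) → SpecAxiom ((quotE A ≐ quotE D) ⊃ (A ≐ D))
    s4j : (A B D E : Wff ε) → SpecAxiom ((evalE A B ≐ evalE D E) ⊃ ((A ≐ D) ∧ (B ≐ E)))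
    s4k : SpecAxiom Ind
    s5a : (A : Wff ε) → SpecAxiom (isVar A ⊃ evalFree A)
    s5b : (A : Wff ε) → SpecAxiom (isCon A ⊃ evalFree A)
    s5c : (A B : Wff ε) → SpecAxiom ((appE A B) ↓ ⊃
            (evalFree (appE A B) ≐ (evalFree A ∧ evalFree B)))
    s5d : (A B : Wff ε) → SpecAxiom ((absE A B) ↓ ⊃ (evalFree (absE A B) ≐ evalFree B))
    s5e : (A B C : Wff ε) → SpecAxiom ((condE A B C) ↓ ⊃
            (evalFree (condE A B C) ≐ (evalFree A ∧ evalFree B ∧ evalFree C)))
    s5f : (A : Wff ε) → SpecAxiom (A ↓ ⊃ evalFree (quotE A))
    s5g : (A B : Wff ε) → SpecAxiom (~ evalFree (evalE A B))
    s6a : ∀ {α} (x : Var α) → SpecAxiom (wff α ⌜ var x ⌝)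
    s6b : ∀ {α} (c : Const α) → SpecAxiom (wff α ⌜ con c ⌝)
    s6c : (α β : Ty) (A B : Wff ε) →
          SpecAxiom ((wff (fn α β) A ∧ wff β B) ⊃ wff α (appE A B))
    s6d : (α β : Ty) (A B : Wff ε) →
          SpecAxiom ((wff ι A ∨ wff o A ∨ wff ε A ∨ wff (pr α β) A) ⊃ (appE A B) ↑)
    s6e : (α β : Ty) (A B : Wff ε) →
          SpecAxiom ((wff (fn α β) A ∧ ~ wff β B) ⊃ (appE A B) ↑)
    s6f : (α β : Ty) (A B : Wff ε) →
          SpecAxiom ((isVar^ α A ∧ wff β B) ⊃ wff (fn β α) (absE A B))
    s6g : (A B : Wff ε) → SpecAxiom (~ isVar A ⊃ (absE A B) ↑)
    s6h : (α : Ty) (A B C : Wff ε) →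
          SpecAxiom ((wff o A ∧ wff α B ∧ wff α C) ⊃ wff α (condE A B C))
    s6i : (α β : Ty) → ¬ (α ≡ β) → (A B C : Wff ε) →
          SpecAxiom ((~ wff o A ∨ (wff α B ∧ wff β C)) ⊃ (condE A B C) ↑)
    s6j : (A : Wff ε) → SpecAxiom (A ↓ ⊃ wff ε (quotE A))
    s6k : (α : Ty) (A B : Wff ε) →
          SpecAxiom ((wff ε A ∧ isVar^ α B) ⊃ wff α (evalE A B))
    s6l : (A B : Wff ε) → SpecAxiom ((~ wff ε A ∨ ~ isVar B) ⊃ (evalE A B) ↑)
    s6m : (α β : Ty) → ¬ (α ≡ β) → (A : Wff ε) → SpecAxiom (~ (wff α A ∧ wff β A))
    s7a : (A : Wff ε) → SpecAxiom (isVar A ⊃ ~ nfi A A)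
    s7b : (A B : Wff ε) → SpecAxiom ((isVar A ∧ isVar B ∧ (A ≠ B)) ⊃ nfi A B)
    s7c : (A B : Wff ε) → SpecAxiom ((isVar A ∧ isCon B) ⊃ nfi A B)
    s7d : (A B C : Wff ε) → SpecAxiom ((isVar A ∧ (appE B C) ↓) ⊃
            (nfi A (appE B C) ≐ (nfi A B ∧ nfi A C)))
    s7e : (A B : Wff ε) → SpecAxiom ((isVar A ∧ (absE A B) ↓) ⊃ nfi A (absE A B))
    s7f : (A B C : Wff ε) → SpecAxiom ((isVar A ∧ isVar B ∧ (A ≠ B) ∧ (absE B C) ↓) ⊃
            (nfi A (absE B C) ≐ nfi A C))
    s7g : (A D E F : Wff ε) → SpecAxiom ((isVar A ∧ (condE D E F) ↓) ⊃
            (nfi A (condE D E F) ≐ (nfi A D ∧ nfi A E ∧ nfi A F)))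
    s7h : (A B : Wff ε) → SpecAxiom ((isVar A ∧ B ↓) ⊃ nfi A (quotE B))
    s7i : (α : Ty) (A B C : Wff ε) →
          SpecAxiom ((isVar A ∧ isVar^ α C ∧ (evalE B C) ↓) ⊃
            (nfi A (evalE B C) ≐
              (syn-closed B ∧ evalFree^ ε B ∧ evalFree^ α (⟦ B ⟧ ε) ∧ nfi A (⟦ B ⟧ ε))))
    s7j : (A B : Wff ε) → SpecAxiom (~ isVar A ⊃ nfi A B)
    s8a : (A : Wff ε) → SpecAxiom (isVar A ⊃ (cleanse A ≐ A))
    s8b : (A : Wff ε) → SpecAxiom (isCon A ⊃ (cleanse A ≐ A))
    s8c : (A B : Wff ε) → SpecAxiom ((appE A B) ↓ ⊃
            (cleanse (appE A B) ≃ appE (cleanse A) (cleanse B)))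
    s8d : (A B : Wff ε) → SpecAxiom ((absE A B) ↓ ⊃
            (cleanse (absE A B) ≃ absE A (cleanse B)))
    s8e : (A B C : Wff ε) → SpecAxiom ((condE A B C) ↓ ⊃
            (cleanse (condE A B C) ≃ condE (cleanse A) (cleanse B) (cleanse C)))
    s8f : (A : Wff ε) → SpecAxiom (cleanse (quotE A) ≃ quotE A)
    s8g : (α : Ty) (A B : Wff ε) →
          SpecAxiom ((isVar^ α B ∧ (evalE A B) ↓) ⊃
            (cleanse (evalE A B) ≃
              cond (syn-closed (cleanse A) ∧ evalFree^ α (⟦ cleanse A ⟧ ε))
                   (⟦ cleanse A ⟧ ε) (bot ε)))
    s9a : (α : Ty) (A B : Wff ε) →
          SpecAxiom ((wff α A ∧ isVar^ α B) ⊃ (sub A B B ≐ cleanse A))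
    s9b : (α : Ty) (A B C : Wff ε) →
          SpecAxiom ((wff α A ∧ isVar^ α B ∧ isVar C ∧ (B ≠ C)) ⊃ (sub A B C ≐ C))
    s9c : (α : Ty) (A B C : Wff ε) →
          SpecAxiom ((wff α A ∧ isVar^ α B ∧ isCon C) ⊃ (sub A B C ≐ C))
    s9d : (α : Ty) (A B D E : Wff ε) →
          SpecAxiom ((wff α A ∧ isVar^ α B ∧ (appE D E) ↓) ⊃
            (sub A B (appE D E) ≃ appE (sub A B D) (sub A B E)))
    s9e : (α : Ty) (A B E : Wff ε) →
          SpecAxiom ((wff α A ∧ isVar^ α B ∧ (absE B E) ↓) ⊃
            (sub A B (absE B E) ≃ absE B (cleanse E)))
    s9f : (α : Ty) (A B D E : Wff ε) →
          SpecAxiom ((wff α A ∧ isVar^ α B ∧ isVar D ∧ (B ≠ D) ∧ (absE D E) ↓) ⊃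
            (sub A B (absE D E) ≃
              cond (nfi B E ∨ nfi D A) (absE D (sub A B E)) (bot ε)))
    s9g : (α : Ty) (A B D E F : Wff ε) →
          SpecAxiom ((wff α A ∧ isVar^ α B ∧ (condE D E F) ↓) ⊃
            (sub A B (condE D E F) ≃ condE (sub A B D) (sub A B E) (sub A B F)))
    s9h : (α : Ty) (A B C : Wff ε) →
          SpecAxiom ((wff α A ∧ isVar^ α B ∧ C ↓) ⊃ (sub A B (quotE C) ≐ quotE C))
    s9i : (α β : Ty) (A B D E : Wff ε) →
          SpecAxiom ((wff α A ∧ isVar^ α B ∧ isVar^ β E ∧ (evalE D E) ↓) ⊃
            (sub A B (evalE D E) ≃
              cond (syn-closed (sub A B D) ∧ evalFree^ β (⟦ sub A B D ⟧ ε))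
                   (sub A B (⟦ sub A B D ⟧ ε)) (bot ε)))
    s9j : (α : Ty) (A B C : Wff ε) →
          SpecAxiom ((wff α A ∧ ~ isVar^ α B) ⊃ (sub A B C) ↑)

  data Axiom : Wff o → Set where
    ax1  : (G : Wff (fn o o)) (x : Var o) → ¬ Occ x G →
           Axiom ((app G Tₒ ∧ app G Fₒ) ≐ ∀ₒ x (app G (var x)))
    ax2  : ∀ {α} (A B : Wff α) (H : Wff (fn o α)) →
           Axiom ((A ≐ B) ⊃ (app H A ≐ app H B))
    ax3  : ∀ {α β} (F G : Wff (fn α β)) (x : Var β) → ¬ Occ x F → ¬ Occ x G →
           Axiom ((F ↓ ∧ G ↓) ⊃ ((F ≐ G) ≐ ∀ₒ x (app F (var x) ≃ app G (var x))))
    ax4-1 : ∀ {α β} (A : Wff α) (x : Var α) (B C : Wff β) →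
           Axiom ((A ↓ ∧ (sub ⌜ A ⌝ ⌜ var x ⌝ ⌜ B ⌝ ≐ ⌜ C ⌝)) ⊃ (app (lam x B) A ≃ C))
    ax4-2 : ∀ {α} (A : Wff α) (x : Var α) → Axiom (app (lam x (var x)) A ≃ A)
    ax4-3 : ∀ {α β} (A : Wff α) (x : Var α) (y : Var β) → DistinctVars x y →
           Axiom (A ↓ ⊃ (app (lam x (var y)) A ≃ var y))
    ax4-4 : ∀ {α β} (A : Wff α) (x : Var α) (c : Const β) →
           Axiom (A ↓ ⊃ (app (lam x (con c)) A ≃ con c))
    ax4-5 : ∀ {α β γ} (A : Wff α) (x : Var α) (B : Wff (fn γ β)) (C : Wff β) →
           Axiom (app (lam x (app B C)) A ≃ app (app (lam x B) A) (app (lam x C) A))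
    ax4-6 : ∀ {α β} (A : Wff α) (x : Var α) (B : Wff β) →
           Axiom (A ↓ ⊃ (app (lam x (lam x B)) A ≐ lam x B))
    ax4-7 : ∀ {α β γ} (A : Wff α) (x : Var α) (y : Var β) (B : Wff γ) → DistinctVars x y →
           Axiom ((A ↓ ∧ (nfi ⌜ var x ⌝ ⌜ B ⌝ ∨ nfi ⌜ var y ⌝ ⌜ A ⌝)) ⊃
                  (app (lam x (lam y B)) A ≐ lam y (app (lam x B) A)))
    ax4-8 : ∀ {α β} (A : Wff α) (x : Var α) (B : Wff o) (C D : Wff β) →
           Axiom (app (lam x (cond B C D)) A ≃
                  cond (app (lam x B) A) (app (lam x C) A) (app (lam x D) A))
    ax4-9 : ∀ {α β} (A : Wff α) (x : Var α) (B : Wff β) →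
           Axiom (A ↓ ⊃ (app (lam x ⌜ B ⌝) A ≃ ⌜ B ⌝))
    ax4-10 : ∀ {α β} (x : Var α) (B : Wff β) → Axiom (app (lam x B) (var x) ≃ B)
    ax5  : (φ : PF) → Tautology φ → (σ : ℕ → Wff o) → Axiom (inst σ φ)
    ax6a : ∀ {α} (x : Var α) → Axiom ((var x) ↓)
    ax6b : ∀ {α} (c : Const α) → Axiom ((con c) ↓)
    ax6c : ∀ {β} (A : Wff (fn o β)) (B : Wff β) → Axiom ((app A B) ↓)
    ax6d : ∀ {α β} (A : Wff (fn α β)) (B : Wff β) →
           Axiom ((A ↑ ∨ B ↑) ⊃ (app A B ≃ bot α))
    ax6e : ∀ {α β} (x : Var α) (B : Wff β) → Axiom ((lam x B) ↓)
    ax6f : (A B C : Wff o) → Axiom ((cond A B C) ↓)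
    ax6g : ∀ {α} (A : Wff α) → Axiom (⌜ A ⌝ ↓)
    ax6h : (A : Wff ε) → Axiom ((⟦ A ⟧ o) ↓)
    ax6i : ∀ {α} (A : Wff α) → Axiom ((⟦ ⌜ ⌜ A ⌝ ⌝ ⟧ ε) ↓)
    ax6j : (α : Ty) (A : Wff ε) → Axiom (~ evalFree^ α A ⊃ (⟦ A ⟧ α ≃ bot α))
    ax6k : (α : Ty) → T (notO α) → Axiom ((bot α) ↑)
    ax7  : ∀ {α} (A : Wff α) → Axiom (A ≃ A)
    ax8a : ∀ {α} {p : T (notO α)} (x : Var α) (A : Wff o) →
           Axiom (∃₁ x A ≐ (Iota {p = p} x A) ↓)
    ax8b : ∀ {α} {p : T (notO α)} (x : Var α) (A B : Wff o) →
           Axiom ((∃₁ x A ∧ (sub ⌜ Iota {p = p} x A ⌝ ⌜ var x ⌝ ⌜ A ⌝ ≐ ⌜ B ⌝)) ⊃ B)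
    ax9a : ∀ {α β} (A C : Wff α) (B D : Wff β) →
           Axiom ((pairW A B ≐ pairW C D) ≐ ((A ≐ C) ∧ (B ≐ D)))
    ax9b : ∀ {α β} (A : Wff (pr α β)) (x : Var α) (y : Var β) →
           DistinctVars x y → ¬ Occ x A → ¬ Occ y A →
           Axiom (A ↓ ⊃ ∃ₒ x (∃ₒ y (A ≐ pairW (var x) (var y))))
    ax10a : ∀ {α} (B C : Wff α) → Axiom (cond Tₒ B C ≃ B)
    ax10b : ∀ {α} (B C : Wff α) → Axiom (cond Fₒ B C ≃ C)
    ax10c : (α : Ty) (A : Wff o) (B C : Wff ε) →
           Axiom (⟦ cond A B C ⟧ α ≃ cond A (⟦ B ⟧ α) (⟦ C ⟧ α))
    ax11a : ∀ {α} (x : Var α) → Axiom (⟦ ⌜ var x ⌝ ⟧ α ≐ var x)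
    ax11b : ∀ {α} (c : Const α) → Axiom (⟦ ⌜ con c ⌝ ⟧ α ≐ con c)
    ax11c : (α β : Ty) (A B : Wff ε) →
           Axiom (wff (fn α β) A ⊃ (⟦ appE A B ⟧ α ≃ app (⟦ A ⟧ (fn α β)) (⟦ B ⟧ β)))
    ax11d : ∀ {α} (β : Ty) (x : Var α) (B : Wff ε) →
           Axiom (nfi ⌜ var x ⌝ ⌜ B ⌝ ⊃ (⟦ absE ⌜ var x ⌝ B ⟧ (fn β α) ≃ lam x (⟦ B ⟧ β)))
    ax11e : (α : Ty) (A B C : Wff ε) →
           Axiom (⟦ condE A B C ⟧ α ≃ cond (⟦ A ⟧ o) (⟦ B ⟧ α) (⟦ C ⟧ α))
    ax11f : (A : Wff ε) → Axiom ((⟦ quotE A ⟧ ε) ↓ ⊃ (⟦ quotE A ⟧ ε ≐ A))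
    ax12 : ∀ {A} → SpecAxiom A → Axiom A

  -- Rule R1: replacement of one occurrence, not inside a quotation
  -- (bound variables of λ and second arguments of evaluations are
  -- variables, not wffs, in this representation, so they are never replaced).

  data Repl {α} (A B : Wff α) : ∀ {γ} → Wff γ → Wff γ → Set where
    here  : Repl A B A B
    appL  : ∀ {β γ} {M M' : Wff (fn γ β)} {N : Wff β} →
            Repl A B M M' → Repl A B (app M N) (app M' N)
    appR  : ∀ {β γ} {M : Wff (fn γ β)} {N N' : Wff β} →
            Repl A B N N' → Repl A B (app M N) (app M N')
    lamR  : ∀ {β γ} {x : Var β} {M M' : Wff γ} →
            Repl A B M M' → Repl A B (lam x M) (lam x M')
    cond1 : ∀ {γ} {M M' : Wff o} {N K : Wff γ} →
            Repl A B M M' → Repl A B (cond M N K) (cond M' N K)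
    cond2 : ∀ {γ} {M : Wff o} {N N' K : Wff γ} →
            Repl A B N N' → Repl A B (cond M N K) (cond M N' K)
    cond3 : ∀ {γ} {M : Wff o} {N K K' : Wff γ} →
            Repl A B K K' → Repl A B (cond M N K) (cond M N K')
    evL   : ∀ {γ} {M M' : Wff ε} {x : Var γ} →
            Repl A B M M' → Repl A B (ev M x) (ev M' x)

  infix 2 ⊢_
  data ⊢_ : Wff o → Set where
    axiom : ∀ {A} → Axiom A → ⊢ A
    R1    : ∀ {α} {A B : Wff α} {C C' : Wff o} →
            ⊢ (A ≃ B) → ⊢ C → Repl A B C C' → ⊢ C'
    R2    : ∀ {A B : Wff o} → ⊢ A → ⊢ (A ⊃ B) → ⊢ B

module Submission where

-- Axiom S1 rewrites ⌜ D ⌝ into the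
-- ε-constructor applied to the quotations of the immediate subwffs, and the
-- axioms of group 11 push the evaluation through that constructor; the
-- induction hypotheses then close each case.  The side conditions of group 11
-- are that the quotation of a subwff has the right syntactic type (axioms S6,
-- which for an abstraction needs var^α ⌜ x ⌝, a β-redex) and that the bound
-- variable is not free in a quotation (axiom S7).

open import Defs
open import Data.Nat using (ℕ; zero; suc)
open import Data.Bool using (true; false)
open import Relation.Binary.PropositionalEquality using (refl)

module Derivations (NC : Ty → Set) where
  open Lang NC

  twoAtoms : Wff o → Wff o → ℕ → Wff o
  twoAtoms P R zero          = P
  twoAtoms P R (suc zero)    = R
  twoAtoms P R (suc (suc _)) = Tₒ

  ⊃-weaken : ∀ {P} (R : Wff o) → ⊢ P → ⊢ (R ⊃ P)
  ⊃-weaken {P} R ⊢P = R2 ⊢P (axiom (ax5 φ taut (twoAtoms P R)))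
    where
    φ : PF
    φ = pimp (atom 0) (pimp (atom 1) (atom 0))

    taut : Tautology φ
    taut ρ with ρ 0 | ρ 1
    ... | true  | true  = refl
    ... | true  | false = refl
    ... | false | true  = refl
    ... | false | false = refl

  ∧-intro : ∀ {P R} → ⊢ P → ⊢ R → ⊢ (P ∧ R)
  ∧-intro {P} {R} ⊢P ⊢R = R2 ⊢R (R2 ⊢P (axiom (ax5 φ taut (twoAtoms P R))))
    where
    φ : PF
    φ = pimp (atom 0) (pimp (atom 1) (pand (atom 0) (atom 1)))

    taut : Tautology φ
    taut ρ with ρ 0 | ρ 1
    ... | true  | true  = refl
    ... | true  | false = refl
    ... | false | true  = refl
    ... | false | false = refl

  ∨-introʳ : ∀ {R} (P : Wff o) → ⊢ R → ⊢ (P ∨ R)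
  ∨-introʳ {R} P ⊢R = R2 ⊢R (axiom (ax5 φ taut (twoAtoms P R)))
    where
    φ : PF
    φ = pimp (atom 1) (por (atom 0) (atom 1))

    taut : Tautology φ
    taut ρ with ρ 0 | ρ 1
    ... | true  | true  = refl
    ... | true  | false = refl
    ... | false | true  = refl
    ... | false | false = refl

  ≐⇒≃ : ∀ {α} {A B : Wff α} → ⊢ (A ≐ B) → ⊢ (A ≃ B)
  ≐⇒≃ {A = A} {B} = ⊃-weaken ((A ↓) ∨ (B ↓))

  -- All binary connectives, = and the ε-constructors are curried applications
  -- app (app F A) B, so one pair of contexts reaches their arguments.
  arg₁ : ∀ {α β γ δ} {a a' : Wff α} {F : Wff (fn (fn δ γ) β)} {A A' : Wff β} {B : Wff γ} →
         Repl a a' A A' → Repl a a' (app (app F A) B) (app (app F A') B)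
  arg₁ p = appL (appR p)

  arg₂ : ∀ {α γ δ} {a a' : Wff α} {F : Wff (fn δ γ)} {B B' : Wff γ} →
         Repl a a' B B' → Repl a a' (app F B) (app F B')
  arg₂ = appR

  rewrite-by : ∀ {α} {A B : Wff α} {C C' : Wff o} → ⊢ (A ≃ B) → Repl A B C C' → ⊢ C → ⊢ C'
  rewrite-by A≃B p ⊢C = R1 A≃B ⊢C p

  -- B occurs three times in X ≃ B: on the right of X ≐ B and twice in B ↓.
  ≃-rewriteʳ : ∀ {α β} {a a' : Wff α} {X B B' : Wff β} →
               ⊢ (a ≃ a') → Repl a a' B B' → ⊢ (X ≃ B) → ⊢ (X ≃ B')
  ≃-rewriteʳ e p h =
    rewrite-by e (arg₂ (arg₂ p))
      (rewrite-by e (arg₁ (arg₂ (arg₂ p)))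
        (rewrite-by e (arg₁ (arg₂ (arg₁ p))) h))

  ≃-rewriteˡ : ∀ {α β} {a a' : Wff α} {X X' B : Wff β} →
               ⊢ (a ≃ a') → Repl a a' X X' → ⊢ (X ≃ B) → ⊢ (X' ≃ B)
  ≃-rewriteˡ e p h =
    rewrite-by e (arg₂ (arg₁ p))
      (rewrite-by e (arg₁ (arg₁ (arg₂ p)))
        (rewrite-by e (arg₁ (arg₁ (arg₁ p))) h))

  ≃-sym : ∀ {α} {A B : Wff α} → ⊢ (A ≃ B) → ⊢ (B ≃ A)
  ≃-sym {A = A} A≃B = ≃-rewriteˡ A≃B here (axiom (ax7 A))

  quote≃ℰ : ∀ {α} (A : Wff α) → ⊢ (⌜ A ⌝ ≃ ℰ A)
  quote≃ℰ A = ≐⇒≃ (axiom (ax12 (s1 A)))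

  ℰ-defined : ∀ {α} (A : Wff α) → ⊢ ((ℰ A) ↓)
  ℰ-defined A = rewrite-by (quote≃ℰ A) (arg₂ here)
                  (rewrite-by (quote≃ℰ A) (arg₁ here) (axiom (ax6g A)))

  quote-app : ∀ {α β} (A : Wff (fn α β)) (B : Wff β) → ⊢ (⌜ app A B ⌝ ≃ appE ⌜ A ⌝ ⌜ B ⌝)
  quote-app A B = ≃-rewriteʳ (≃-sym (quote≃ℰ B)) (arg₂ here)
                    (≃-rewriteʳ (≃-sym (quote≃ℰ A)) (arg₁ here) (quote≃ℰ (app A B)))

  quote-lam : ∀ {α β} (x : Var β) (A : Wff α) → ⊢ (⌜ lam x A ⌝ ≃ absE ⌜ var x ⌝ ⌜ A ⌝)
  quote-lam x A = ≃-rewriteʳ (≃-sym (quote≃ℰ A)) (arg₂ here) (quote≃ℰ (lam x A))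

  quote-cond : ∀ {α} (A : Wff o) (B C : Wff α) →
               ⊢ (⌜ cond A B C ⌝ ≃ condE ⌜ A ⌝ ⌜ B ⌝ ⌜ C ⌝)
  quote-cond A B C =
    ≃-rewriteʳ (≃-sym (quote≃ℰ C)) (arg₂ here)
      (≃-rewriteʳ (≃-sym (quote≃ℰ B)) (arg₁ here)
        (≃-rewriteʳ (≃-sym (quote≃ℰ A)) (appL (arg₁ here)) (quote≃ℰ (cond A B C))))

  quote-quo : ∀ {α} (A : Wff α) → ⊢ (⌜ quo A ⌝ ≃ quotE ⌜ A ⌝)
  quote-quo A = ≃-rewriteʳ (≃-sym (quote≃ℰ A)) (arg₂ here) (quote≃ℰ (quo A))

  nfi-quoted-quotation : ∀ {β γ} (y : Var β) (A : Wff γ) → ⊢ nfi ⌜ var y ⌝ ⌜ ⌜ A ⌝ ⌝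
  nfi-quoted-quotation y A =
    rewrite-by (≃-sym (quote≃ℰ (quo A))) (arg₂ here)
      (R2 (∧-intro (axiom (ax12 (s2a y))) (ℰ-defined A))
          (axiom (ax12 (s7h ⌜ var y ⌝ (ℰ A)))))

  data Subst {α} (x : Var α) (A : Wff α) : ∀ {β} → Wff β → Wff β → Set where
    hit  : Subst x A (var x) A
    miss : ∀ {β} {y : Var β} → DistinctVars x y → Subst x A (var y) (var y)
    con  : ∀ {β} {c : Const β} → Subst x A (con c) (con c)
    app  : ∀ {β γ} {B B' : Wff (fn γ β)} {C C' : Wff β} →
           Subst x A B B' → Subst x A C C' → Subst x A (app B C) (app B' C')
    lam  : ∀ {β γ} {y : Var β} {B B' : Wff γ} →
           DistinctVars x y → Subst x A B B' → Subst x A (lam y B) (lam y B')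

  β-closed : ∀ {α β} {x : Var α} {A : Wff α} {B B' : Wff β} →
             (∀ {γ} (y : Var γ) → ⊢ nfi ⌜ var y ⌝ ⌜ A ⌝) → ⊢ (A ↓) →
             Subst x A B B' → ⊢ (app (lam x B) A ≃ B')
  β-closed {x = x} {A} closed A↓ hit = axiom (ax4-2 A x)
  β-closed {x = x} {A} closed A↓ (miss {y = y} x≢y) = R2 A↓ (axiom (ax4-3 A x y x≢y))
  β-closed {x = x} {A} closed A↓ (con {c = c}) = R2 A↓ (axiom (ax4-4 A x c))
  β-closed {x = x} {A} closed A↓ (app {B = B} {C = C} s t) =
    ≃-rewriteʳ (β-closed closed A↓ t) (arg₂ here)
      (≃-rewriteʳ (β-closed closed A↓ s) (appL here) (axiom (ax4-5 A x B C)))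
  β-closed {x = x} {A} closed A↓ (lam {y = y} {B = B} x≢y s) =
    ≃-rewriteʳ (β-closed closed A↓ s) (lamR here)
      (≐⇒≃ (R2 (∧-intro A↓ (∨-introʳ (nfi ⌜ var x ⌝ ⌜ B ⌝) (closed y)))
               (axiom (ax4-7 A x y B x≢y))))

  isVar^-quote : ∀ {α} (z : Var α) → ⊢ isVar^ α ⌜ var z ⌝
  isVar^-quote {α} z =
    rewrite-by (≃-sym (β-closed (λ y → nfi-quoted-quotation y (var z)) (axiom (ax6g (var z)))
                                 body))
               here
      (∧-intro (axiom (ax12 (s2a z))) (axiom (ax12 (s6a z))))
    where
    Z : Wff ε
    Z = ⌜ var z ⌝

    ε≢o : ∀ {n} → DistinctVars (xV ε) (v {o} n)
    ε≢o ()

    ε≢ooo : ∀ {n} → DistinctVars (xV ε) (v {fn (fn o o) o} n)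
    ε≢ooo ()

    Tₒ-fixed : Subst (xV ε) Z Tₒ Tₒ
    Tₒ-fixed = app (app con con) con

    -- AND binds and uses only variables of types o and ooo, never x_ε.
    AND-fixed : Subst (xV ε) Z AND AND
    AND-fixed =
      lam ε≢o (lam ε≢o
        (app (app con (lam ε≢ooo (app (app (miss ε≢ooo) Tₒ-fixed) Tₒ-fixed)))
             (lam ε≢ooo (app (app (miss ε≢ooo) (miss ε≢o)) (miss ε≢o)))))

    body : Subst (xV ε) Z (isVar xε ∧ wff α xε) (isVar Z ∧ wff α Z)
    body = app (app AND-fixed (app con hit)) (app con hit)

  wff-quote : ∀ {δ} {D : Wff δ} → EvalFree D → ⊢ wff δ ⌜ D ⌝
  wff-quote (efVar {x = x}) = axiom (ax12 (s6a x))
  wff-quote (efCon {c = c}) = axiom (ax12 (s6b c))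
  wff-quote (efApp {α} {β} {A} {B} a b) =
    rewrite-by (≃-sym (quote-app A B)) (arg₂ here)
      (R2 (∧-intro (wff-quote a) (wff-quote b)) (axiom (ax12 (s6c α β ⌜ A ⌝ ⌜ B ⌝))))
  wff-quote (efLam {α} {β} {x} {A} a) =
    rewrite-by (≃-sym (quote-lam x A)) (arg₂ here)
      (R2 (∧-intro (isVar^-quote x) (wff-quote a)) (axiom (ax12 (s6f β α ⌜ var x ⌝ ⌜ A ⌝))))
  wff-quote (efCond {α} {A} {B} {C} a b c) =
    rewrite-by (≃-sym (quote-cond A B C)) (arg₂ here)
      (R2 (∧-intro (∧-intro (wff-quote a) (wff-quote b)) (wff-quote c))
          (axiom (ax12 (s6h α ⌜ A ⌝ ⌜ B ⌝ ⌜ C ⌝))))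
  wff-quote (efQuo {A = A}) =
    rewrite-by (≃-sym (quote-quo A)) (arg₂ here) (R2 (axiom (ax6g A)) (axiom (ax12 (s6j ⌜ A ⌝))))

  eval-quote : ∀ {δ} (D : Wff δ) → EvalFree D → ⊢ (⟦ ⌜ D ⌝ ⟧ δ ≃ D)
  eval-quote (var x) efVar = ≐⇒≃ (axiom (ax11a x))
  eval-quote (con c) efCon = ≐⇒≃ (axiom (ax11b c))
  eval-quote (app {α} {β} A B) (efApp a b) =
    ≃-rewriteˡ (≃-sym (quote-app A B)) (evL here)
      (≃-rewriteʳ (eval-quote B b) (arg₂ here)
        (≃-rewriteʳ (eval-quote A a) (appL here)
          (R2 (wff-quote a) (axiom (ax11c α β ⌜ A ⌝ ⌜ B ⌝)))))
  eval-quote (lam {α} {β} x A) (efLam a) =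
    ≃-rewriteˡ (≃-sym (quote-lam x A)) (evL here)
      (≃-rewriteʳ (eval-quote A a) (lamR here)
        (R2 (nfi-quoted-quotation x A) (axiom (ax11d α x ⌜ A ⌝))))
  eval-quote (cond {α} A B C) (efCond a b c) =
    ≃-rewriteˡ (≃-sym (quote-cond A B C)) (evL here)
      (≃-rewriteʳ (eval-quote C c) (cond3 here)
        (≃-rewriteʳ (eval-quote B b) (cond2 here)
          (≃-rewriteʳ (eval-quote A a) (cond1 here)
            (axiom (ax11e α ⌜ A ⌝ ⌜ B ⌝ ⌜ C ⌝)))))
  eval-quote (quo A) efQuo =
    ≃-rewriteˡ (≃-sym (quote-quo A)) (evL here)
      (≐⇒≃ (R2 (rewrite-by (quote-quo A) (arg₂ (evL here))
                 (rewrite-by (quote-quo A) (arg₁ (evL here)) (axiom (ax6i A))))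
               (axiom (ax11f ⌜ A ⌝))))

mainTheorem6 : (NC : Ty → Set) → let open Lang NC in
    ∀ {δ : Ty} (D : Wff δ) → EvalFree D → ⊢ (⟦ ⌜ D ⌝ ⟧ δ ≃ D)
mainTheorem6 NC = Derivations.eval-quote NC
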